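{- Let $G$ be a finite simple graph and $m_0=\max_k\{\mathrm{mun}(k)-k\}$, the maximum over $1\le k\le|V(G)|$. Then $\mathrm{Hun}(G)>m_0$.
   Context: For $S\subseteq V(G)$ let $N(S)$ be the set of vertices adjacent to some vertex of $S$. $\mathrm{mun}(k)=\min\{|N(W)|: W\subseteq V(G),|W|=k\}$. Hunter strategy: finite sequence $H=(H_1,\dots,H_m)$ of multisets of vertices; $R_H(0)=V(G)$, $R_H(i)=N(R_H(i-1)\setminus H_i)$; winning if $R_H(i)=\emptyset$ for some $i$. $\mathrm{Hun}(G)$ is the minimum over winning strategies of $\max_i|H_i|$ (multiplicities counted). -}

module Defs where

open import Data.Bool using (Bool; true; false; _∧_; not)
open import Data.Nat using (ℕ; zero; suc; _⊔_; _⊓_)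
open import Data.Fin using (Fin; _≟_)
open import Data.Fin.Subset using (Subset; ∣_∣; ⊤; ⊥)
open import Data.Vec using (Vec; []; _∷_; tabulate; lookup)
open import Data.Bool.ListAction using (any)
open import Data.List using (List; []; _∷_; length; allFin; foldr; map; filter; upTo; _++_)
open import Data.List.Relation.Unary.Any using (Any)
open import Data.Integer as ℤ using (ℤ; +_)
open import Relation.Binary.PropositionalEquality using (_≡_)
open import Relation.Nullary.Decidable using (⌊_⌋)
open import Data.Nat.Properties using () renaming (_≟_ to _≟ℕ_)
open import Data.Product using (Σ; _×_)

record Graph (n : ℕ) : Set where
  field
    adj    : Fin n → Fin n → Bool
    sym    : ∀ u v → adj u v ≡ adj v u
    irrefl : ∀ v → adj v v ≡ false
open Graph public

N : ∀ {n} → Graph n → Subset n → Subset n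
N {n} G S = tabulate λ v → any (λ u → lookup S u ∧ adj G u v) (allFin n)

-- Multisets of vertices are lists of vertices; size counts multiplicities.
Multiset : ℕ → Set
Multiset n = List (Fin n)

_∖ₘ_ : ∀ {n} → Subset n → Multiset n → Subset n
S ∖ₘ H = tabulate λ v → lookup S v ∧ not (any (λ u → ⌊ u ≟ v ⌋) H)

Strategy : ℕ → Set
Strategy n = List (Multiset n)

run : ∀ {n} → Graph n → Subset n → Strategy n → List (Subset n)
run G R []       = []
run G R (h ∷ hs) = let R' = N G (R ∖ₘ h) in R' ∷ run G R' hs

rounds : ∀ {n} → Graph n → Strategy n → List (Subset n)
rounds G H = ⊤ ∷ run G ⊤ H

Winning : ∀ {n} → Graph n → Strategy n → Set
Winning G H = Any (λ S → S ≡ ⊥) (rounds G H)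

width : ∀ {n} → Strategy n → ℕ
width H = foldr (λ h m → length h ⊔ m) 0 H

allSubsets : (n : ℕ) → List (Subset n)
allSubsets zero    = [] ∷ []
allSubsets (suc n) = map (true ∷_) (allSubsets n) ++ map (false ∷_) (allSubsets n)

-- mun(k) = min { |N(W)| : |W| = k }.  (The fold starts at n, an upper
-- bound for every |N(W)|, so for 0 ≤ k ≤ n this is exactly the minimum.)
mun : ∀ {n} → Graph n → ℕ → ℕ
mun {n} G k =
  foldr (λ W m → ∣ N G W ∣ ⊓ m) n
        (filter (λ W → ∣ W ∣ ≟ℕ k) (allSubsets n))

m₀ : ∀ {n} → Graph (suc n) → ℤ
m₀ {n} G = foldr ℤ._⊔_ (val 1) (map (λ i → val (suc i)) (upTo (suc n)))
  where
  val : ℕ → ℤ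
  val k = + mun G k ℤ.- + k

-- If some k ≥ 1 has mun(k) − k ≥ w, a hunter using at most w shots per round
-- can never win: whenever |R| ≥ mun(k), after removing at most w vertices at
-- least k remain, and the neighbourhood of any k of them already has at least
-- mun(k) vertices, so |R| ≥ mun(k) ≥ k ≥ 1 holds in every round.
module Submission where

open import Defs
open import Data.Nat using (ℕ; suc)
open import Data.Integer using (+_; _<_)

open import Data.Bool using (Bool; T; _∧_; _∨_; not)
open import Data.Bool.ListAction using (any)
open import Data.Bool.Properties using (T-≡; T-∧)
open import Data.Fin using (Fin; _≟_)
open import Data.Fin.Subset using (Subset; _∈_; _⊆_; _∪_; ⁅_⁆; ∣_∣; ⊥; inside; outside)
open import Data.Fin.Subset.Properties
  using (p⊆q⇒∣p∣≤∣q∣; x∈p∪q⁺; x∈⁅x⁆; ∣⁅x⁆∣≡1; ∣⊥∣≡0; ∣⊤∣≡n; ⊥⊆; s⊆s; in⊆in)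
open import Data.Integer as ℤ using (ℤ; _⊖_)
import Data.Integer.Properties as ℤ
open import Data.List using ([]; _∷_; length; allFin; foldr; map; filter; upTo)
import Data.List.Membership.Propositional as List
open import Data.List.Membership.Propositional.Properties
  using (∈-allFin; ∈-filter⁺; ∈-map⁺; ∈-++⁺ˡ; ∈-++⁺ʳ)
open import Data.List.Relation.Unary.Any as Any using (Any; here; there; satisfied)
open import Data.List.Relation.Unary.Any.Properties using (any⁺; any⁻)
open import Data.Nat as ℕ using (zero; _+_; _≤_; z≤n; s≤s; _⊓_)
open import Data.Nat.Properties as ℕ using () renaming (_≟_ to _≟ℕ_)
open import Data.Product using (∃-syntax; _×_; _,_)
open import Data.Sum using (inj₁; inj₂)
open import Data.Vec using ([]; _∷_; tabulate; lookup)
open import Data.Vec.Properties using ([]=⇒lookup; lookup⇒[]=; lookup∘tabulate)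
open import Function using (_⇔_; mk⇔; Equivalence)
open import Relation.Binary.PropositionalEquality as ≡ using (_≡_; refl; trans; cong; subst)
open import Relation.Nullary using (¬_; yes; no; contradiction)
open import Relation.Nullary.Decidable using (⌊_⌋)

open Equivalence using (to; from)

private
  variable
    n k : ℕ

∈-tabulate⇔ : ∀ {f : Fin n → Bool} {x} → x ∈ tabulate f ⇔ T (f x)
∈-tabulate⇔ {f = f} {x} = mk⇔
  (λ x∈ → from T-≡ (trans (≡.sym (lookup∘tabulate f x)) ([]=⇒lookup x∈)))
  (λ t → lookup⇒[]= x _ (trans (lookup∘tabulate f x) (to T-≡ t)))

∈⇔T-lookup : ∀ {p : Subset n} {x} → x ∈ p ⇔ T (lookup p x)
∈⇔T-lookup {p = p} {x} = mk⇔ (λ x∈ → from T-≡ ([]=⇒lookup x∈)) (λ t → lookup⇒[]= x p (to T-≡ t))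

∣p∪q∣≤∣p∣+∣q∣ : (p q : Subset n) → ∣ p ∪ q ∣ ≤ ∣ p ∣ + ∣ q ∣
∣p∪q∣≤∣p∣+∣q∣ []            []            = z≤n
∣p∪q∣≤∣p∣+∣q∣ (outside ∷ p) (outside ∷ q) = ∣p∪q∣≤∣p∣+∣q∣ p q
∣p∪q∣≤∣p∣+∣q∣ (outside ∷ p) (inside ∷ q)  =
  ℕ.≤-trans (s≤s (∣p∪q∣≤∣p∣+∣q∣ p q)) (ℕ.≤-reflexive (≡.sym (ℕ.+-suc ∣ p ∣ ∣ q ∣)))
∣p∪q∣≤∣p∣+∣q∣ (inside ∷ p)  (outside ∷ q) = s≤s (∣p∪q∣≤∣p∣+∣q∣ p q)
∣p∪q∣≤∣p∣+∣q∣ (inside ∷ p)  (inside ∷ q)  =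
  s≤s (ℕ.≤-trans (∣p∪q∣≤∣p∣+∣q∣ p q) (ℕ.+-monoʳ-≤ ∣ p ∣ (ℕ.n≤1+n ∣ q ∣)))

∃-⊆-of-size : (p : Subset n) → k ≤ ∣ p ∣ → ∃[ q ] q ⊆ p × ∣ q ∣ ≡ k
∃-⊆-of-size {n} {zero} p _ = ⊥ , ⊥⊆ , ∣⊥∣≡0 n
∃-⊆-of-size {k = suc k} (inside ∷ p) (s≤s k≤∣p∣) with ∃-⊆-of-size p k≤∣p∣
... | q , q⊆p , ∣q∣≡k = inside ∷ q , in⊆in q⊆p , cong suc ∣q∣≡k
∃-⊆-of-size {k = suc k} (outside ∷ p) k≤∣p∣ with ∃-⊆-of-size p k≤∣p∣
... | q , q⊆p , ∣q∣≡k = outside ∷ q , s⊆s q⊆p , ∣q∣≡k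

module _ (G : Graph n) where

  ∈-N⁻ : ∀ {S : Subset n} {v} → v ∈ N G S → ∃[ u ] u ∈ S × T (adj G u v)
  ∈-N⁻ v∈ with satisfied (any⁻ _ (allFin n) (to ∈-tabulate⇔ v∈))
  ... | u , t with to T-∧ t
  ...   | u∈S , uv = u , from ∈⇔T-lookup u∈S , uv

  ∈-N⁺ : ∀ {S : Subset n} {u v} → u ∈ S → T (adj G u v) → v ∈ N G S
  ∈-N⁺ {u = u} u∈S uv = from ∈-tabulate⇔
    (any⁺ _ (Any.map (λ { refl → from T-∧ (to ∈⇔T-lookup u∈S , uv) }) (∈-allFin u)))

  N-mono : ∀ {S S′ : Subset n} → S ⊆ S′ → N G S ⊆ N G S′
  N-mono S⊆S′ v∈ with ∈-N⁻ v∈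
  ... | u , u∈S , uv = ∈-N⁺ (S⊆S′ u∈S) uv

⊆-∖ₘ-[] : (S : Subset n) → S ⊆ S ∖ₘ []
⊆-∖ₘ-[] S x∈S = from ∈-tabulate⇔ (from T-∧ (to ∈⇔T-lookup x∈S , _))

∖ₘ-⊆-∖ₘ-∷-∪ : (S : Subset n) (h : Fin n) (H : Multiset n) → S ∖ₘ H ⊆ (S ∖ₘ (h ∷ H)) ∪ ⁅ h ⁆
∖ₘ-⊆-∖ₘ-∷-∪ S h H {v} v∈ with h ≟ v
... | yes refl = x∈p∪q⁺ (inj₂ (x∈⁅x⁆ h))
... | no h≢v = x∈p∪q⁺ (inj₁ (from ∈-tabulate⇔ v∈S∖ₘh∷H))
  where
  v∈S∖ₘh∷H : T (lookup S v ∧ not (⌊ h ≟ v ⌋ ∨ any (λ u → ⌊ u ≟ v ⌋) H))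
  v∈S∖ₘh∷H with h ≟ v
  ... | yes h≡v = contradiction h≡v h≢v
  ... | no _    = to ∈-tabulate⇔ v∈

∣S∣≤∣S∖ₘH∣+∣H∣ : (S : Subset n) (H : Multiset n) → ∣ S ∣ ≤ ∣ S ∖ₘ H ∣ + length H
∣S∣≤∣S∖ₘH∣+∣H∣ S [] = ℕ.≤-trans (p⊆q⇒∣p∣≤∣q∣ (⊆-∖ₘ-[] S)) (ℕ.m≤m+n _ 0)
∣S∣≤∣S∖ₘH∣+∣H∣ S (h ∷ H) = begin
  ∣ S ∣                                      ≤⟨ ∣S∣≤∣S∖ₘH∣+∣H∣ S H ⟩
  ∣ S ∖ₘ H ∣ + length H                      ≤⟨ ℕ.+-monoˡ-≤ (length H) ∣S∖ₘH∣≤∣S∖ₘh∷H∣+1 ⟩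
  ∣ S ∖ₘ (h ∷ H) ∣ + 1 + length H            ≡⟨ ℕ.+-assoc ∣ S ∖ₘ (h ∷ H) ∣ 1 (length H) ⟩
  ∣ S ∖ₘ (h ∷ H) ∣ + length (h ∷ H)          ∎
  where
  open ℕ.≤-Reasoning
  ∣S∖ₘH∣≤∣S∖ₘh∷H∣+1 : ∣ S ∖ₘ H ∣ ≤ ∣ S ∖ₘ (h ∷ H) ∣ + 1
  ∣S∖ₘH∣≤∣S∖ₘh∷H∣+1 = begin
    ∣ S ∖ₘ H ∣                          ≤⟨ p⊆q⇒∣p∣≤∣q∣ (∖ₘ-⊆-∖ₘ-∷-∪ S h H) ⟩
    ∣ (S ∖ₘ (h ∷ H)) ∪ ⁅ h ⁆ ∣          ≤⟨ ∣p∪q∣≤∣p∣+∣q∣ (S ∖ₘ (h ∷ H)) ⁅ h ⁆ ⟩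
    ∣ S ∖ₘ (h ∷ H) ∣ + ∣ ⁅ h ⁆ ∣         ≡⟨ cong (ℕ._+_ ∣ S ∖ₘ (h ∷ H) ∣) (∣⁅x⁆∣≡1 h) ⟩
    ∣ S ∖ₘ (h ∷ H) ∣ + 1                ∎

foldr-⊓-≤ : ∀ {A : Set} (f : A → ℕ) z {x xs} → x List.∈ xs → foldr (λ y m → f y ⊓ m) z xs ≤ f x
foldr-⊓-≤ f z (here refl) = ℕ.m⊓n≤m _ _
foldr-⊓-≤ f z (there x∈) = ℕ.m≤n⇒o⊓m≤n (f _) (foldr-⊓-≤ f z x∈)

foldr-⊓-≤-init : ∀ {A : Set} (f : A → ℕ) z xs → foldr (λ y m → f y ⊓ m) z xs ≤ z
foldr-⊓-≤-init f z []       = ℕ.≤-refl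
foldr-⊓-≤-init f z (x ∷ xs) = ℕ.m≤n⇒o⊓m≤n (f x) (foldr-⊓-≤-init f z xs)

∈-allSubsets : (W : Subset n) → W List.∈ allSubsets n
∈-allSubsets []                    = here refl
∈-allSubsets {suc n} (inside ∷ W)  = ∈-++⁺ˡ (∈-map⁺ (inside ∷_) (∈-allSubsets W))
∈-allSubsets {suc n} (outside ∷ W) =
  ∈-++⁺ʳ (map (inside ∷_) (allSubsets n)) (∈-map⁺ (outside ∷_) (∈-allSubsets W))

module _ (G : Graph n) where

  mun≤∣N∣ : ∀ {W : Subset n} → ∣ W ∣ ≡ k → mun G k ≤ ∣ N G W ∣
  mun≤∣N∣ {k = k} {W} ∣W∣≡k =
    foldr-⊓-≤ (λ W → ∣ N G W ∣) n (∈-filter⁺ (λ W → ∣ W ∣ ≟ℕ k) (∈-allSubsets W) ∣W∣≡k)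

  mun≤n : mun G k ≤ n
  mun≤n {k = k} = foldr-⊓-≤-init (λ W → ∣ N G W ∣) n (filter (λ W → ∣ W ∣ ≟ℕ k) (allSubsets n))

module _ (G : Graph n) {k w : ℕ} (1≤k : 1 ≤ k) (k+w≤mun : k + w ≤ mun G k) where

  round-large : ∀ {R : Subset n} {h : Multiset n} → length h ≤ w →
                mun G k ≤ ∣ R ∣ → mun G k ≤ ∣ N G (R ∖ₘ h) ∣
  round-large {R} {h} ∣h∣≤w large = neighbourhood-large (∃-⊆-of-size (R ∖ₘ h) k≤∣R∖ₘh∣)
    where
    open ℕ.≤-Reasoning
    k≤∣R∖ₘh∣ : k ≤ ∣ R ∖ₘ h ∣
    k≤∣R∖ₘh∣ = ℕ.+-cancelʳ-≤ w k ∣ R ∖ₘ h ∣ (begin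
      k + w                  ≤⟨ k+w≤mun ⟩
      mun G k                ≤⟨ large ⟩
      ∣ R ∣                  ≤⟨ ∣S∣≤∣S∖ₘH∣+∣H∣ R h ⟩
      ∣ R ∖ₘ h ∣ + length h  ≤⟨ ℕ.+-monoʳ-≤ ∣ R ∖ₘ h ∣ ∣h∣≤w ⟩
      ∣ R ∖ₘ h ∣ + w         ∎)
    neighbourhood-large : ∃[ W ] W ⊆ R ∖ₘ h × ∣ W ∣ ≡ k → mun G k ≤ ∣ N G (R ∖ₘ h) ∣
    neighbourhood-large (W , W⊆R∖ₘh , ∣W∣≡k) = begin
      mun G k          ≤⟨ mun≤∣N∣ G {W = W} ∣W∣≡k ⟩
      ∣ N G W ∣        ≤⟨ p⊆q⇒∣p∣≤∣q∣ (N-mono G {W} W⊆R∖ₘh) ⟩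
      ∣ N G (R ∖ₘ h) ∣ ∎

  large⇒≢⊥ : ∀ {R : Subset n} → mun G k ≤ ∣ R ∣ → ¬ R ≡ ⊥
  large⇒≢⊥ large refl = ℕ.<⇒≢ 0<∣⊥∣ (≡.sym (∣⊥∣≡0 n))
    where
    0<∣⊥∣ : 0 ℕ.< ∣ ⊥ {n} ∣
    0<∣⊥∣ = ℕ.≤-trans 1≤k (ℕ.≤-trans (ℕ.m≤m+n k w) (ℕ.≤-trans k+w≤mun large))

  rounds-nonempty : ∀ {R : Subset n} (H : Strategy n) → width H ≤ w → mun G k ≤ ∣ R ∣ →
                    ¬ Any (_≡ ⊥) (R ∷ run G R H)
  rounds-nonempty     H       _       large (here R≡⊥)  = large⇒≢⊥ large R≡⊥
  rounds-nonempty {R} (h ∷ H) width≤w large (there R∅) =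
    rounds-nonempty H (ℕ.m⊔n≤o⇒n≤o (length h) (width H) width≤w)
      (round-large {R} {h} (ℕ.m⊔n≤o⇒m≤o (length h) (width H) width≤w) large) R∅

narrow-strategy-loses : (G : Graph n) (H : Strategy n) → 1 ≤ k → k + width H ≤ mun G k →
                        ¬ Winning G H
narrow-strategy-loses {n} G H 1≤k bound =
  rounds-nonempty G 1≤k bound H ℕ.≤-refl (subst (mun G _ ≤_) (≡.sym (∣⊤∣≡n n)) (mun≤n G))

winning⇒mun<k+width : (G : Graph n) (H : Strategy n) → Winning G H → 1 ≤ k → mun G k ℕ.< k + width H
winning⇒mun<k+width G H win 1≤k = ℕ.≰⇒> (λ bound → narrow-strategy-loses G H 1≤k bound win)

m<n+o⇒+m-+n<+o : ∀ {m} n o → m ℕ.< n + o → + m ℤ.- + n < + o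
m<n+o⇒+m-+n<+o {m} n o m<n+o = begin-strict
  + m ℤ.- + n     ≡⟨ ℤ.[+m]-[+n]≡m⊖n m n ⟩
  m ⊖ n           <⟨ ℤ.⊖-monoˡ-< n m<n+o ⟩
  n + o ⊖ n       ≡⟨ ℤ.distribˡ-⊖-+-pos o n n ⟨
  n ⊖ n ℤ.+ + o   ≡⟨ cong (ℤ._+ + o) (ℤ.n⊖n≡0 n) ⟩
  + o             ∎
  where open ℤ.≤-Reasoning

foldr-⊔-< : ∀ {A : Set} (g : A → ℤ) {b x} xs → b < x → (∀ a → g a < x) →
            foldr ℤ._⊔_ b (map g xs) < x
foldr-⊔-< g []       b<x g<x = b<x
foldr-⊔-< g {b} {x} (a ∷ xs) b<x g<x with ℤ.⊔-sel (g a) (foldr ℤ._⊔_ b (map g xs))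
... | inj₁ ⊔≡ga   = subst (_< x) (≡.sym ⊔≡ga) (g<x a)
... | inj₂ ⊔≡rest = subst (_< x) (≡.sym ⊔≡rest) (foldr-⊔-< g xs b<x g<x)

proposition2p9 : (n : ℕ) (G : Graph (suc n)) (H : Strategy (suc n)) →
                 Winning G H → m₀ G < + width H
proposition2p9 n G H win =
  foldr-⊔-< _ (upTo (suc n)) (value<width (s≤s z≤n)) (λ i → value<width (s≤s z≤n))
  where
  value<width : ∀ {k} → 1 ≤ k → + mun G k ℤ.- + k < + width H
  value<width {k} 1≤k = m<n+o⇒+m-+n<+o k (width H) (winning⇒mun<k+width G H win 1≤k)
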